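{- Let $k,d,h$ be positive integers and let $C_h$ be a chain of size $h$. If $\mathcal{F}\subset[k]^d$ does not contain a strong copy of $C_h$, then $|\mathcal{F}|\le d(h-1)k^{d-1}$.
   Context: $[k]^d$ denotes the set of vectors with entries in $\{1,\dots,k\}$, ordered coordinatewise ($\mathbf x\preceq\mathbf y$ iff $\mathbf x(i)\le\mathbf y(i)$ for all $i$). For a poset $Q$, a subset $Q'\subset[k]^d$ is a strong copy of $Q$ if it is an induced copy of $Q$ (there is a bijection $\pi:Q\to Q'$ with $x\le_Q y$ iff $\pi(x)\preceq\pi(y)$) and, whenever $\mathbf x,\mathbf y\in Q'$ satisfy $\mathbf x\prec\mathbf y$, we have $\mathbf x(i)<\mathbf y(i)$ for every $i\in[d]$ (incomparable pairs may share coordinates). -}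

module Defs where

open import Data.Nat using (ℕ; _≤_; _<_)
open import Data.Fin using (Fin; toℕ)
open import Data.Vec using (Vec; lookup)
open import Data.Product using (_×_; Σ)
open import Data.List using (List)
open import Data.List.Membership.Propositional using (_∈_)
open import Relation.Binary.PropositionalEquality using (_≡_)
open import Relation.Nullary using (¬_)
open import Function.Bundles using (_⇔_)
open import Function.Definitions using (Injective)

-- A point of [k]^d: the entry value (toℕ c + 1) ∈ {1,…,k} is encoded by c : Fin k.
Point : ℕ → ℕ → Set
Point k d = Vec (Fin k) d

_⪯_ : ∀ {k d} → Point k d → Point k d → Set
_⪯_ {d = d} x y = (i : Fin d) → toℕ (lookup x i) ≤ toℕ (lookup y i)

_≺_ : ∀ {k d} → Point k d → Point k d → Set
x ≺ y = (x ⪯ y) × ¬ (x ≡ y)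

-- The chain C_h: the poset Fin h with its usual (total) order.
record StrongChainCopy {k d : ℕ} (h : ℕ) (F : List (Point k d)) : Set where
  field
    π        : Fin h → Point k d
    injective : Injective _≡_ _≡_ π
    inF      : (i : Fin h) → π i ∈ F
    induced  : (i j : Fin h) → (toℕ i ≤ toℕ j) ⇔ (π i ⪯ π j)
    strong   : (i j : Fin h) → π i ≺ π j →
               (c : Fin d) → toℕ (lookup (π i) c) < toℕ (lookup (π j) c)

module Submission where

-- Write x ≪ y when x is strictly below y in every coordinate.
-- A ≪-chain of h points of F is exactly a strong copy of C_h (for d ≥ 1),
-- so it suffices to bound families without ≪-chains of length h.
--
-- (1) Antichains are small.  Code a point x ∈ [k]^d by the index i of a
--     minimal coordinate together with the offsets x(c) - x(i) of the other
--     d - 1 coordinates; there are d·k^(d-1) codes.  Two points with the same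
--     code are translates of each other along the diagonal, hence equal or
--     ≪-comparable.  So a ≪-antichain has at most d·k^(d-1) elements.
-- (2) Mirsky-type peeling.  The ≪-minimal elements M of F form an antichain;
--     every other element has an element of F ≪-below it, so a ≪-chain of
--     length h in F ∖ M extends to one of length h+1 in F.  Induction on h
--     gives |F| ≤ (h-1)·d·k^(d-1) when F has no ≪-chain of length h.

open import Defs
open import Data.Nat using (ℕ; _≤_; _*_; _∸_; _^_; NonZero)
open import Data.List using (List; length)
open import Data.List.Relation.Unary.Unique.Propositional using (Unique)
open import Relation.Nullary using (¬_)

open import Data.Nat using (zero; suc; _+_; _<_; z≤n; s≤s; _<?_)
open import Data.Nat.Properties
open import Data.Fin as Fin using (Fin; toℕ; fromℕ<; punchIn; punchOut; combine; funToFin; finToFun)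
open import Data.Fin.Properties as FinP
  using (toℕ-injective; toℕ<n; toℕ-fromℕ<; punchIn-punchOut; combine-injective; finToFun-funToFin; injective⇒≤; all?)
open import Data.Vec using (lookup; tabulate)
open import Data.Vec.Properties using (tabulate∘lookup; tabulate-cong)
open import Data.List using ([]; _∷_; filter; allFin)
import Data.List as List
open import Data.List.Extrema.Nat using (argmin; f[argmin]≤f[xs])
open import Data.List.Membership.Propositional using (_∈_; find; lose)
open import Data.List.Membership.Propositional.Properties using (∈-filter⁻; ∈-lookup; ∈-allFin)
open import Data.List.Relation.Unary.Any using (Any; here; any?)
open import Data.List.Relation.Unary.All as All using ()
open import Data.List.Relation.Unary.AllPairs using (_∷_)
import Data.List.Relation.Unary.Unique.Propositional.Properties as Unique
open import Data.Product using (_×_; _,_; proj₁; proj₂)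
open import Data.Sum using (_⊎_; inj₁; inj₂)
open import Data.Empty using (⊥-elim)
open import Relation.Nullary using (Dec; ¬?; yes; no)
open import Relation.Binary.PropositionalEquality
open import Relation.Binary.Definitions using (Tri; tri<; tri≈; tri>)
open import Function using (_∘_)
open import Function.Bundles using (mk⇔)

module _ {A : Set} where

  lookup-injective : {xs : List A} → Unique xs →
                     ∀ {i j} → List.lookup xs i ≡ List.lookup xs j → i ≡ j
  lookup-injective (_ ∷ _)      {Fin.zero}  {Fin.zero}  _ = refl
  lookup-injective (x∉xs ∷ _)   {Fin.zero}  {Fin.suc j} e = ⊥-elim (All.lookup x∉xs (∈-lookup j) e)
  lookup-injective (x∉xs ∷ _)   {Fin.suc i} {Fin.zero}  e = ⊥-elim (All.lookup x∉xs (∈-lookup i) (sym e))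
  lookup-injective (_ ∷ unique) {Fin.suc i} {Fin.suc j} e = cong Fin.suc (lookup-injective unique e)

  length-≤-injection : ∀ {n} (xs : List A) → Unique xs → (f : A → Fin n) →
                       (∀ {x y} → x ∈ xs → y ∈ xs → f x ≡ f y → x ≡ y) →
                       length xs ≤ n
  length-≤-injection xs unique f inj =
    injective⇒≤ {f = f ∘ List.lookup xs}
      (λ {i} {j} e → lookup-injective unique (inj (∈-lookup i) (∈-lookup j) e))

  length-filter-split : ∀ {P : A → Set} (P? : ∀ x → Dec (P x)) (xs : List A) →
                        length xs ≡ length (filter P? xs) + length (filter (¬? ∘ P?) xs)
  length-filter-split P? [] = refl
  length-filter-split P? (x ∷ xs) with P? x
  ... | yes _ = cong suc (length-filter-split P? xs)
  ... | no  _ = trans (cong suc (length-filter-split P? xs)) (sym (+-suc _ _))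

module _ {k d : ℕ} where

  coord : Point k d → Fin d → ℕ
  coord x c = toℕ (lookup x c)

  _≪_ : Point k d → Point k d → Set
  x ≪ y = ∀ c → coord x c < coord y c

  ≪? : ∀ x y → Dec (x ≪ y)
  ≪? x y = all? (λ c → coord x c <? coord y c)

  ≪-trans : ∀ {x y z} → x ≪ y → y ≪ z → x ≪ z
  ≪-trans x≪y y≪z c = <-trans (x≪y c) (y≪z c)

  point-ext : ∀ x y → (∀ c → coord x c ≡ coord y c) → x ≡ y
  point-ext x y same = begin
    x                   ≡⟨ tabulate∘lookup x ⟨
    tabulate (lookup x) ≡⟨ tabulate-cong (λ c → toℕ-injective (same c)) ⟩
    tabulate (lookup y) ≡⟨ tabulate∘lookup y ⟩
    y                   ∎
    where open ≡-Reasoning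

  record ≪-Chain (h : ℕ) (F : List (Point k d)) : Set where
    field
      point      : Fin h → Point k d
      member     : ∀ i → point i ∈ F
      increasing : ∀ i j → i Fin.< j → point i ≪ point j

  open ≪-Chain

  singleton-chain : ∀ {x F} → x ∈ F → ≪-Chain 1 F
  singleton-chain {x} x∈F = record
    { point = λ _ → x ; member = λ _ → x∈F ; increasing = λ { Fin.zero Fin.zero () } }

  extend-chain : ∀ {h F R y} → y ∈ F → (∀ {z} → z ∈ R → z ∈ F) →
                 (s : ≪-Chain (suc h) R) → y ≪ point s Fin.zero → ≪-Chain (suc (suc h)) F
  extend-chain {h} {F} {R} {y} y∈F R⊆F s y≪bottom =
    record { point = point′ ; member = member′ ; increasing = increasing′ }
    where
    point′ : Fin (suc (suc h)) → Point k d
    point′ Fin.zero    = y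
    point′ (Fin.suc i) = point s i
    member′ : ∀ i → point′ i ∈ F
    member′ Fin.zero    = y∈F
    member′ (Fin.suc i) = R⊆F (member s i)
    increasing′ : ∀ i j → i Fin.< j → point′ i ≪ point′ j
    increasing′ Fin.zero (Fin.suc Fin.zero)    _ = y≪bottom
    increasing′ Fin.zero (Fin.suc (Fin.suc j)) _ =
      ≪-trans {y} {point s Fin.zero} {point s (Fin.suc j)}
              y≪bottom (increasing s Fin.zero (Fin.suc j) (s≤s z≤n))
    increasing′ (Fin.suc i) (Fin.suc j) (s≤s i<j) = increasing s i j i<j

≪-chain⇒strong-copy : ∀ {k d h} {F : List (Point k (suc d))} →
                      ≪-Chain h F → StrongChainCopy h F
≪-chain⇒strong-copy {k} {d} {h} {F} s = record
  { π = point ; injective = injective ; inF = member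
  ; induced = λ i j → mk⇔ (monotone i j) (reflecting i j) ; strong = strong }
  where
  open ≪-Chain s
  -- distinct points of the chain differ in the first coordinate
  separated : ∀ {i j} → i Fin.< j → point i ≢ point j
  separated i<j e = <-irrefl (cong (λ x → coord x Fin.zero) e) (increasing _ _ i<j Fin.zero)
  injective : ∀ {i j} → point i ≡ point j → i ≡ j
  injective {i} {j} e with FinP.<-cmp i j
  ... | tri< i<j _ _ = ⊥-elim (separated i<j e)
  ... | tri≈ _ i≡j _ = i≡j
  ... | tri> _ _ j<i = ⊥-elim (separated j<i (sym e))
  monotone : ∀ i j → toℕ i ≤ toℕ j → point i ⪯ point j
  monotone i j i≤j c with m≤n⇒m<n∨m≡n i≤j
  ... | inj₁ i<j = <⇒≤ (increasing i j i<j c)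
  ... | inj₂ i≡j = ≤-reflexive (cong (λ t → coord (point t) c) (toℕ-injective i≡j))
  reflecting : ∀ i j → point i ⪯ point j → toℕ i ≤ toℕ j
  reflecting i j pi⪯pj = ≮⇒≥ (λ j<i → <⇒≱ (increasing j i j<i Fin.zero) (pi⪯pj Fin.zero))
  strong : ∀ i j → point i ≺ point j → point i ≪ point j
  strong i j (pi⪯pj , pi≢pj) with FinP.<-cmp i j
  ... | tri< i<j _ _ = increasing i j i<j
  ... | tri≈ _ i≡j _ = ⊥-elim (pi≢pj (cong point i≡j))
  ... | tri> _ _ j<i = ⊥-elim (<⇒≱ (increasing j i j<i Fin.zero) (pi⪯pj Fin.zero))

-- Two shifts of one offset vector, compared by the size of the shift.
shifted-< : ∀ {a b m n} → m ≤ a → n ≤ b → a ∸ m ≡ b ∸ n → m < n → a < b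
shifted-< {a} {b} {m} {n} m≤a n≤b same m<n = begin-strict
  a           ≡⟨ m∸n+n≡m m≤a ⟨
  a ∸ m + m   <⟨ +-monoʳ-< (a ∸ m) m<n ⟩
  a ∸ m + n   ≡⟨ cong (_+ n) same ⟩
  b ∸ n + n   ≡⟨ m∸n+n≡m n≤b ⟩
  b           ∎
  where open ≤-Reasoning

shifted-≡ : ∀ {a b m n} → m ≤ a → n ≤ b → a ∸ m ≡ b ∸ n → m ≡ n → a ≡ b
shifted-≡ {a} {b} {m} {n} m≤a n≤b same m≡n = begin
  a           ≡⟨ m∸n+n≡m m≤a ⟨
  a ∸ m + m   ≡⟨ cong₂ _+_ same m≡n ⟩
  b ∸ n + n   ≡⟨ m∸n+n≡m n≤b ⟩
  b           ∎
  where open ≡-Reasoning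

funToFin-injective : ∀ {m n} {f g : Fin m → Fin n} → funToFin f ≡ funToFin g → ∀ j → f j ≡ g j
funToFin-injective {f = f} {g} e j =
  trans (sym (finToFun-funToFin f j)) (trans (cong (λ t → finToFun t j) e) (finToFun-funToFin g j))

module Diagonal {k d : ℕ} where

  Pt : Set
  Pt = Point k (suc d)

  minIndex : Pt → Fin (suc d)
  minIndex x = argmin (coord x) Fin.zero (allFin (suc d))

  minCoord : Pt → ℕ
  minCoord x = coord x (minIndex x)

  minCoord≤ : ∀ x c → minCoord x ≤ coord x c
  minCoord≤ x c = All.lookup (f[argmin]≤f[xs] {f = coord x} Fin.zero (allFin (suc d))) (∈-allFin c)

  offset : Pt → Fin (suc d) → Fin k
  offset x c = fromℕ< (≤-<-trans (m∸n≤m (coord x c) (minCoord x)) (toℕ<n (lookup x c)))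

  code : Pt → Fin (suc d * k ^ d)
  code x = combine (minIndex x) (funToFin (offset x ∘ punchIn (minIndex x)))

  offset-at-minIndex : ∀ x {c} → minIndex x ≡ c → coord x c ∸ minCoord x ≡ 0
  offset-at-minIndex x refl = n∸n≡0 (minCoord x)

  same-code⇒same-offsets : ∀ x y → code x ≡ code y →
                           ∀ c → coord x c ∸ minCoord x ≡ coord y c ∸ minCoord y
  same-code⇒same-offsets x y e c = offsets-agree (ix Fin.≟ c)
    where
    ix = minIndex x
    iy = minIndex y
    parts : ix ≡ iy × funToFin (offset x ∘ punchIn ix) ≡ funToFin (offset y ∘ punchIn iy)
    parts = combine-injective ix (funToFin (offset x ∘ punchIn ix))
                              iy (funToFin (offset y ∘ punchIn iy)) e
    offsets-agree : Dec (ix ≡ c) → coord x c ∸ minCoord x ≡ coord y c ∸ minCoord y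
    offsets-agree (yes ix≡c) =
      trans (offset-at-minIndex x ix≡c) (sym (offset-at-minIndex y (trans (sym (proj₁ parts)) ix≡c)))
    offsets-agree (no ix≢c) = begin
      coord x c ∸ minCoord x          ≡⟨ toℕ-fromℕ< _ ⟨
      toℕ (offset x c)                ≡⟨ cong (toℕ ∘ offset x) (punchIn-punchOut ix≢c) ⟨
      toℕ (offset x (punchIn ix j))   ≡⟨ cong toℕ (funToFin-injective (proj₂ parts) j) ⟩
      toℕ (offset y (punchIn iy j))   ≡⟨ cong (λ t → toℕ (offset y (punchIn t j))) (proj₁ parts) ⟨
      toℕ (offset y (punchIn ix j))   ≡⟨ cong (toℕ ∘ offset y) (punchIn-punchOut ix≢c) ⟩
      toℕ (offset y c)                ≡⟨ toℕ-fromℕ< _ ⟩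
      coord y c ∸ minCoord y          ∎
      where
      open ≡-Reasoning
      j = punchOut ix≢c

  -- Points with the same offset vector lie on one diagonal line, so they are
  -- equal or ≪-comparable according to their minimal coordinates.
  same-offsets⇒comparable : ∀ x y → (∀ c → coord x c ∸ minCoord x ≡ coord y c ∸ minCoord y) →
                            x ≡ y ⊎ x ≪ y ⊎ y ≪ x
  same-offsets⇒comparable x y same = compare (<-cmp (minCoord x) (minCoord y))
    where
    compare : Tri (minCoord x < minCoord y) (minCoord x ≡ minCoord y) (minCoord y < minCoord x) →
              x ≡ y ⊎ x ≪ y ⊎ y ≪ x
    compare (tri< mx<my _ _) = inj₂ (inj₁ λ c →
      shifted-< (minCoord≤ x c) (minCoord≤ y c) (same c) mx<my)
    compare (tri≈ _ mx≡my _) = inj₁ (point-ext x y λ c →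
      shifted-≡ (minCoord≤ x c) (minCoord≤ y c) (same c) mx≡my)
    compare (tri> _ _ my<mx) = inj₂ (inj₂ λ c →
      shifted-< (minCoord≤ y c) (minCoord≤ x c) (sym (same c)) my<mx)

  antichain-bound : (A : List Pt) → Unique A → (∀ {x y} → x ∈ A → y ∈ A → ¬ x ≪ y) →
                    length A ≤ suc d * k ^ d
  antichain-bound A unique antichain = length-≤-injection A unique code injective
    where
    injective : ∀ {x y} → x ∈ A → y ∈ A → code x ≡ code y → x ≡ y
    injective {x} {y} x∈A y∈A e = equal (same-offsets⇒comparable x y (same-code⇒same-offsets x y e))
      where
      equal : x ≡ y ⊎ x ≪ y ⊎ y ≪ x → x ≡ y
      equal (inj₁ x≡y)        = x≡y
      equal (inj₂ (inj₁ x≪y)) = ⊥-elim (antichain x∈A y∈A x≪y)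
      equal (inj₂ (inj₂ y≪x)) = ⊥-elim (antichain y∈A x∈A y≪x)

-- Each step removes
-- the ≪-minimal elements, an antichain, and lowers the longest chain.

module Peeling {k d : ℕ} (N : ℕ)
  (antichain-bound : (A : List (Point k d)) → Unique A →
                     (∀ {x y} → x ∈ A → y ∈ A → ¬ x ≪ y) → length A ≤ N) where

  chain-free-bound : ∀ h (F : List (Point k d)) → Unique F → ¬ ≪-Chain (suc h) F →
                     length F ≤ h * N
  chain-free-bound zero []      _ _       = z≤n
  chain-free-bound zero (x ∷ _) _ noChain = ⊥-elim (noChain (singleton-chain (here refl)))
  chain-free-bound (suc h) F unique noChain = begin
    length F                      ≡⟨ length-filter-split hasBelow? F ⟩
    length upper + length minimal ≡⟨ +-comm (length upper) (length minimal) ⟩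
    length minimal + length upper ≤⟨ +-mono-≤ minimal-bound upper-bound ⟩
    N + h * N ∎
    where
    open ≤-Reasoning
    hasBelow : Point k d → Set
    hasBelow x = Any (_≪ x) F
    hasBelow? : ∀ x → Dec (hasBelow x)
    hasBelow? x = any? (λ y → ≪? y x) F
    upper minimal : List (Point k d)
    upper   = filter hasBelow? F
    minimal = filter (¬? ∘ hasBelow?) F

    from-minimal : ∀ {z} → z ∈ minimal → z ∈ F × ¬ hasBelow z
    from-minimal = ∈-filter⁻ (¬? ∘ hasBelow?) {xs = F}
    from-upper : ∀ {z} → z ∈ upper → z ∈ F × hasBelow z
    from-upper = ∈-filter⁻ hasBelow? {xs = F}

    -- nothing in F lies below a minimal element, in particular no other minimal one
    minimal-antichain : ∀ {x y} → x ∈ minimal → y ∈ minimal → ¬ x ≪ y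
    minimal-antichain x∈M y∈M x≪y = proj₂ (from-minimal y∈M) (lose (proj₁ (from-minimal x∈M)) x≪y)
    minimal-bound : length minimal ≤ N
    minimal-bound = antichain-bound minimal (Unique.filter⁺ _ unique) minimal-antichain

    -- a chain in the upper part extends below its bottom element
    upper-chain-free : ¬ ≪-Chain (suc h) upper
    upper-chain-free s with find (proj₂ (from-upper (≪-Chain.member s Fin.zero)))
    ... | _ , y∈F , y≪bottom = noChain (extend-chain y∈F (proj₁ ∘ from-upper) s y≪bottom)
    upper-bound : length upper ≤ h * N
    upper-bound = chain-free-bound h upper (Unique.filter⁺ _ unique) upper-chain-free

lemma3 : (k d h : ℕ) → .{{NonZero k}} → .{{NonZero d}} → .{{NonZero h}} →
    (F : List (Point k d)) → Unique F →
    ¬ StrongChainCopy h F →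
    length F ≤ d * (h ∸ 1) * k ^ (d ∸ 1)
lemma3 k (suc d) (suc h) F unique noCopy = begin
  length F                  ≤⟨ chain-free-bound h F unique (noCopy ∘ ≪-chain⇒strong-copy) ⟩
  h * (suc d * k ^ d)       ≡⟨ *-assoc h (suc d) (k ^ d) ⟨
  h * suc d * k ^ d         ≡⟨ cong (_* k ^ d) (*-comm h (suc d)) ⟩
  suc d * h * k ^ d         ∎
  where
  open ≤-Reasoning
  open Peeling (suc d * k ^ d) (Diagonal.antichain-bound {k} {d})
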